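{- Let $\to_a\,=\,\multimap\cup\to_g$. (1) If $t\to_\beta^* s$, then $t\to_a^* s$; moreover there is $s'$ such that $t\multimap^* s'\to_g^* s$. (2) If $t\to_a^* u$, then $u=_\beta t$; therefore there is $s$ with $t\to_\beta^* s$ and $u\to_a^* s$.
   Context: $\lambda$-terms: $s,t ::= x \mid \lambda x.t \mid st$, modulo $\alpha$-conversion with the distinct names convention (every bound variable has a name distinct from all other bound and free variables); $\mathsf{FV}$ denotes free variables; $\to_\beta$ is $\beta$-reduction closed under all contexts and $=_\beta$ $\beta$-equivalence. Contexts have one hole $\square$, plugging is without renaming. E-contexts: $E ::= \square \mid E_1[\lambda x.E_2]\,t$ ($E_1,E_2$ E-contexts). A fresh copy $s'$ of a term $s$ is an $\alpha$-equivalent copy in which all bound variables are renamed to names not used elsewhere. Linear reduction $\multimap$ is the closure under arbitrary contexts of the rule $E[\lambda x.C[x]]\,s\multimap E[\lambda x.C[s']]\,s$, where $E$ is an E-context, $C$ is a context whose hole stands for one occurrence of $x$ bound by the displayed $\lambda x$, and $s'$ is a fresh copy of $s$. Garbage reduction $\to_g$ is the closure under contexts of $E[\lambda x.t]\,s\to_g E[t]$ when $x\notin\mathsf{FV}(t)$ ($E$ an E-context). $^*$ denotes reflexive-transitive closure. -}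

module Defs where

open import Data.Nat using (ℕ; zero; suc; _+_; _<ᵇ_; compare; less; equal; greater)
open import Data.Bool using (if_then_else_)
open import Relation.Binary.Construct.Closure.ReflexiveTransitive public using (Star)
open import Relation.Binary.Construct.Closure.Equivalence public using (EqClosure)
open import Relation.Binary.Construct.Union public using (_∪_)

-- λ-terms modulo α-conversion, represented by de Bruijn indices
-- (canonical representatives of α-equivalence classes).
data Term : Set where
  var : ℕ → Term
  lam : Term → Term
  app : Term → Term → Term

shift : ℕ → ℕ → Term → Term
shift d c (var k) = if k <ᵇ c then var k else var (k + d)
shift d c (lam t) = lam (shift d (suc c) t)
shift d c (app t u) = app (shift d c t) (shift d c u)

-- subst j s t : replace index j in t by s (shifted by j),
-- decrementing indices above j (the binder is removed).
subst : ℕ → Term → Term → Term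
subst j s (var k) with compare k j
... | less _ _    = var k
... | equal _     = shift j 0 s
... | greater _ m = var (j + m)
subst j s (lam t) = lam (subst (suc j) s t)
subst j s (app t u) = app (subst j s t) (subst j s u)

-- One-hole contexts, plugging without renaming
data Ctx : Set where
  hole : Ctx
  lamC : Ctx → Ctx
  appL : Ctx → Term → Ctx
  appR : Term → Ctx → Ctx

plug : Ctx → Term → Term
plug hole u = u
plug (lamC C) u = lam (plug C u)
plug (appL C t) u = app (plug C u) t
plug (appR t C) u = app t (plug C u)

depth : Ctx → ℕ
depth hole = 0
depth (lamC C) = suc (depth C)
depth (appL C _) = depth C
depth (appR _ C) = depth C

data ECtx : Set where
  hole : ECtx
  ext  : ECtx → ECtx → Term → ECtx

plugE : ECtx → Term → Term
plugE hole u = u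
plugE (ext E₁ E₂ t) u = app (plugE E₁ (lam (plugE E₂ u))) t

depthE : ECtx → ℕ
depthE hole = 0
depthE (ext E₁ E₂ _) = depthE E₁ + suc (depthE E₂)

data Compat (R : Term → Term → Set) : Term → Term → Set where
  root : ∀ {t u} → R t u → Compat R t u
  lamᶜ : ∀ {t u} → Compat R t u → Compat R (lam t) (lam u)
  appˡ : ∀ {t u s} → Compat R t u → Compat R (app t s) (app u s)
  appʳ : ∀ {t u s} → Compat R t u → Compat R (app s t) (app s u)

data βroot : Term → Term → Set where
  beta : ∀ t s → βroot (app (lam t) s) (subst 0 s t)

_→β_ : Term → Term → Set
_→β_ = Compat βroot

_=β_ : Term → Term → Set
_=β_ = EqClosure _→β_

-- Linear root rule: E[λx.C[x]] s ⊸ E[λx.C[s']] s.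
-- The hole of C is an occurrence of the variable bound by the displayed λ
-- iff its index equals depth C.  The copy s' of s is s shifted by the
-- number of binders between the application and the occurrence.
data linroot : Term → Term → Set where
  lin : ∀ E C s →
    linroot (app (plugE E (lam (plug C (var (depth C))))) s)
            (app (plugE E (lam (plug C (shift (depthE E + suc (depth C)) 0 s)))) s)

_⊸_ : Term → Term → Set
_⊸_ = Compat linroot

-- Garbage root rule: E[λx.t] s →g E[t] when x ∉ FV(t).
-- In de Bruijn form, the body does not contain the bound variable iff it
-- is of the form shift 1 0 t; the result is E[t].
data garbroot : Term → Term → Set where
  garb : ∀ E t s → garbroot (app (plugE E (lam (shift 1 0 t))) s) (plugE E t)

_→g_ : Term → Term → Set
_→g_ = Compat garbroot

_→a_ : Term → Term → Set
_→a_ = _⊸_ ∪ _→g_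

-- A β-step (λx.b) a → b[a/x] is simulated by linear steps that replace the
-- occurrences of x in b one at a time by copies of a, followed by one garbage
-- step erasing the now vacuous redex.  Garbage steps can be postponed past
-- linear steps: a linear step in a term is matched by a linear step on the
-- same occurrence in any term that differs from it by inserted garbage redexes.
-- This turns a β-sequence into ⊸* followed by →g*.  Conversely, firing all
-- redexes of the E-context makes both sides of a root ⊸- or →g-step
-- β-reduce to a common term, so →a ⊆ =β, and confluence of β (via Takahashi's
-- parallel reduction) yields the common reduct.

module Submission where

open import Defs
open import Data.Bool using (true; false; if_then_else_)
open import Data.Empty using (⊥-elim)
open import Data.Nat using (ℕ; zero; suc; _+_; _<ᵇ_; compare; less; equal; greater; _<_; _≤_; s≤s)
open import Data.Nat.Properties using (+-suc; +-comm; +-identityʳ; <⇒<ᵇ; <ᵇ⇒<; ≤⇒≯; <-irrefl; <-trans; ≤-trans; <-cmp; m≤m+n; m≤n+m; n≤1+n)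
open import Data.Nat.Tactic.RingSolver using (solve-∀)
open import Data.Product using (_×_; ∃; _,_)
open import Data.Sum using (inj₁; inj₂)
open import Function using (_∘_; id)
open import Relation.Binary using (Tri; tri<; tri≈; tri>)
open import Relation.Binary.PropositionalEquality using (_≡_; _≗_; refl; sym; trans; cong; cong₂; module ≡-Reasoning) renaming (subst to transport; subst₂ to transport₂)
open import Relation.Binary.Construct.Closure.ReflexiveTransitive using (ε; _◅_; _◅◅_)
import Relation.Binary.Construct.Closure.ReflexiveTransitive as Star
open import Relation.Binary.Construct.Closure.ReflexiveTransitive.Properties using () renaming (reflexive to ≡⇒Star)
open import Relation.Binary.Construct.Closure.Symmetric using (fwd; bwd)
import Relation.Binary.Construct.Closure.Equivalence as EqClosure
open import Relation.Binary.Construct.Closure.Equivalence.Properties using (a—↠b⇒a↔b; a—↠b⇒b↔a)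
open import Relation.Binary.Rewriting using (Confluent)

private variable
  j k : ℕ
  a b s t t' u u' : Term

Ren : Set
Ren = ℕ → ℕ

liftᵣ : Ren → Ren
liftᵣ ρ zero    = zero
liftᵣ ρ (suc k) = suc (ρ k)

ren : Ren → Term → Term
ren ρ (var k)   = var (ρ k)
ren ρ (lam t)   = lam (ren (liftᵣ ρ) t)
ren ρ (app t u) = app (ren ρ t) (ren ρ u)

liftᵣ-cong : ∀ {ρ ρ'} → ρ ≗ ρ' → liftᵣ ρ ≗ liftᵣ ρ'
liftᵣ-cong e zero    = refl
liftᵣ-cong e (suc k) = cong suc (e k)

ren-cong : ∀ {ρ ρ'} → ρ ≗ ρ' → ren ρ ≗ ren ρ'
ren-cong e (var k)   = cong var (e k)
ren-cong e (lam t)   = cong lam (ren-cong (liftᵣ-cong e) t)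
ren-cong e (app t u) = cong₂ app (ren-cong e t) (ren-cong e u)

liftᵣ-∘ : ∀ ρ ρ' → liftᵣ ρ ∘ liftᵣ ρ' ≗ liftᵣ (ρ ∘ ρ')
liftᵣ-∘ ρ ρ' zero    = refl
liftᵣ-∘ ρ ρ' (suc k) = refl

ren-∘ : ∀ ρ ρ' t → ren ρ (ren ρ' t) ≡ ren (ρ ∘ ρ') t
ren-∘ ρ ρ' (var k)   = refl
ren-∘ ρ ρ' (lam t)   = cong lam (trans (ren-∘ (liftᵣ ρ) (liftᵣ ρ') t) (ren-cong (liftᵣ-∘ ρ ρ') t))
ren-∘ ρ ρ' (app t u) = cong₂ app (ren-∘ ρ ρ' t) (ren-∘ ρ ρ' u)

liftᵣ-identity : ∀ {ρ} → ρ ≗ id → liftᵣ ρ ≗ id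
liftᵣ-identity e zero    = refl
liftᵣ-identity e (suc k) = cong suc (e k)

ren-identity : ∀ {ρ} → ρ ≗ id → ren ρ ≗ id
ren-identity e (var k)   = cong var (e k)
ren-identity e (lam t)   = cong lam (ren-identity (liftᵣ-identity e) t)
ren-identity e (app t u) = cong₂ app (ren-identity e t) (ren-identity e u)

ren-id : ∀ t → ren id t ≡ t
ren-id = ren-identity (λ _ → refl)

Sub : Set
Sub = ℕ → Term

liftₛ : Sub → Sub
liftₛ σ zero    = var zero
liftₛ σ (suc k) = ren suc (σ k)

sub : Sub → Term → Term
sub σ (var k)   = σ k
sub σ (lam t)   = lam (sub (liftₛ σ) t)
sub σ (app t u) = app (sub σ t) (sub σ u)

infixr 5 _•_
_•_ : Term → Sub → Sub
(a • σ) zero    = a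
(a • σ) (suc k) = σ k

infix 30 _[_]₀
_[_]₀ : Term → Term → Term
t [ a ]₀ = sub (a • var) t

liftₛ-cong : ∀ {σ σ'} → σ ≗ σ' → liftₛ σ ≗ liftₛ σ'
liftₛ-cong e zero    = refl
liftₛ-cong e (suc k) = cong (ren suc) (e k)

sub-cong : ∀ {σ σ'} → σ ≗ σ' → sub σ ≗ sub σ'
sub-cong e (var k)   = e k
sub-cong e (lam t)   = cong lam (sub-cong (liftₛ-cong e) t)
sub-cong e (app t u) = cong₂ app (sub-cong e t) (sub-cong e u)

liftₛ-∘-liftᵣ : ∀ σ ρ → liftₛ σ ∘ liftᵣ ρ ≗ liftₛ (σ ∘ ρ)
liftₛ-∘-liftᵣ σ ρ zero    = refl
liftₛ-∘-liftᵣ σ ρ (suc k) = refl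

sub-ren : ∀ σ ρ t → sub σ (ren ρ t) ≡ sub (σ ∘ ρ) t
sub-ren σ ρ (var k)   = refl
sub-ren σ ρ (lam t)   = cong lam (trans (sub-ren (liftₛ σ) (liftᵣ ρ) t) (sub-cong (liftₛ-∘-liftᵣ σ ρ) t))
sub-ren σ ρ (app t u) = cong₂ app (sub-ren σ ρ t) (sub-ren σ ρ u)

ren-liftₛ : ∀ ρ σ → ren (liftᵣ ρ) ∘ liftₛ σ ≗ liftₛ (ren ρ ∘ σ)
ren-liftₛ ρ σ zero    = refl
ren-liftₛ ρ σ (suc k) = trans (ren-∘ (liftᵣ ρ) suc (σ k)) (sym (ren-∘ suc ρ (σ k)))

ren-sub : ∀ ρ σ t → ren ρ (sub σ t) ≡ sub (ren ρ ∘ σ) t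
ren-sub ρ σ (var k)   = refl
ren-sub ρ σ (lam t)   = cong lam (trans (ren-sub (liftᵣ ρ) (liftₛ σ) t) (sub-cong (ren-liftₛ ρ σ) t))
ren-sub ρ σ (app t u) = cong₂ app (ren-sub ρ σ t) (ren-sub ρ σ u)

sub-liftₛ : ∀ σ τ → sub (liftₛ σ) ∘ liftₛ τ ≗ liftₛ (sub σ ∘ τ)
sub-liftₛ σ τ zero    = refl
sub-liftₛ σ τ (suc k) = trans (sub-ren (liftₛ σ) suc (τ k)) (sym (ren-sub suc σ (τ k)))

sub-sub : ∀ σ τ t → sub σ (sub τ t) ≡ sub (sub σ ∘ τ) t
sub-sub σ τ (var k)   = refl
sub-sub σ τ (lam t)   = cong lam (trans (sub-sub (liftₛ σ) (liftₛ τ) t) (sub-cong (sub-liftₛ σ τ) t))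
sub-sub σ τ (app t u) = cong₂ app (sub-sub σ τ t) (sub-sub σ τ u)

liftₛ-identity : ∀ {σ} → σ ≗ var → liftₛ σ ≗ var
liftₛ-identity e zero    = refl
liftₛ-identity e (suc k) = cong (ren suc) (e k)

sub-identity : ∀ {σ} → σ ≗ var → sub σ ≗ id
sub-identity e (var k)   = e k
sub-identity e (lam t)   = cong lam (sub-identity (liftₛ-identity e) t)
sub-identity e (app t u) = cong₂ app (sub-identity e t) (sub-identity e u)

sub-var : ∀ t → sub var t ≡ t
sub-var = sub-identity (λ _ → refl)

liftₛ-var∘ : ∀ ρ → liftₛ (var ∘ ρ) ≗ var ∘ liftᵣ ρ
liftₛ-var∘ ρ zero    = refl
liftₛ-var∘ ρ (suc k) = refl

sub-var∘ : ∀ ρ t → sub (var ∘ ρ) t ≡ ren ρ t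
sub-var∘ ρ (var k)   = refl
sub-var∘ ρ (lam t)   = cong lam (trans (sub-cong (liftₛ-var∘ ρ) t) (sub-var∘ (liftᵣ ρ) t))
sub-var∘ ρ (app t u) = cong₂ app (sub-var∘ ρ t) (sub-var∘ ρ u)

sub-•-ren-suc : ∀ a σ t → sub (a • σ) (ren suc t) ≡ sub σ t
sub-•-ren-suc a σ = sub-ren (a • σ) suc

sub-[]₀-liftₛ : ∀ a σ t → sub (liftₛ σ) t [ a ]₀ ≡ sub (a • σ) t
sub-[]₀-liftₛ a σ t = trans (sub-sub (a • var) (liftₛ σ) t) (sub-cong pointwise t)
  where
  pointwise : sub (a • var) ∘ liftₛ σ ≗ a • σ
  pointwise zero    = refl
  pointwise (suc k) = trans (sub-•-ren-suc a var (σ k)) (sub-var (σ k))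

sub-[]₀ : ∀ σ a t → sub σ (t [ a ]₀) ≡ sub (liftₛ σ) t [ sub σ a ]₀
sub-[]₀ σ a t = begin
  sub σ (t [ a ]₀)               ≡⟨ sub-sub σ (a • var) t ⟩
  sub (sub σ ∘ (a • var)) t      ≡⟨ sub-cong pointwise t ⟩
  sub (sub σ a • σ) t            ≡⟨ sym (sub-[]₀-liftₛ (sub σ a) σ t) ⟩
  sub (liftₛ σ) t [ sub σ a ]₀   ∎
  where
  open ≡-Reasoning
  pointwise : sub σ ∘ (a • var) ≗ sub σ a • σ
  pointwise zero    = refl
  pointwise (suc k) = refl

ren-[]₀ : ∀ ρ a t → ren ρ (t [ a ]₀) ≡ ren (liftᵣ ρ) t [ ren ρ a ]₀
ren-[]₀ ρ a t = trans (ren-sub ρ (a • var) t) (sym (trans (sub-ren (ren ρ a • var) (liftᵣ ρ) t) (sub-cong pointwise t)))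
  where
  pointwise : (ren ρ a • var) ∘ liftᵣ ρ ≗ ren ρ ∘ (a • var)
  pointwise zero    = refl
  pointwise (suc k) = refl

shiftᵣ : ℕ → ℕ → Ren
shiftᵣ d c k = if k <ᵇ c then k else k + d

liftᵣ-shiftᵣ : ∀ d c → liftᵣ (shiftᵣ d c) ≗ shiftᵣ d (suc c)
liftᵣ-shiftᵣ d c zero = refl
liftᵣ-shiftᵣ d c (suc k) with k <ᵇ c
... | true  = refl
... | false = refl

shift-var : ∀ d c k → shift d c (var k) ≡ var (shiftᵣ d c k)
shift-var d c k with k <ᵇ c
... | true  = refl
... | false = refl

shift≡ren : ∀ d c t → shift d c t ≡ ren (shiftᵣ d c) t
shift≡ren d c (var k)   = shift-var d c k
shift≡ren d c (lam t)   = cong lam (trans (shift≡ren d (suc c) t) (sym (ren-cong (liftᵣ-shiftᵣ d c) t)))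
shift≡ren d c (app t u) = cong₂ app (shift≡ren d c t) (shift≡ren d c u)

shift₀≡ren : ∀ d t → shift d 0 t ≡ ren (_+ d) t
shift₀≡ren d = shift≡ren d 0

shift₁≡ren-suc : ∀ t → shift 1 0 t ≡ ren suc t
shift₁≡ren-suc t = trans (shift₀≡ren 1 t) (ren-cong (λ k → +-comm k 1) t)

shiftᵣ-< : ∀ {d c k} → k < c → shiftᵣ d c k ≡ k
shiftᵣ-< {_} {c} {k} k<c with k <ᵇ c | <⇒<ᵇ k<c
... | true | _ = refl

shiftᵣ-≥ : ∀ {d c k} → c ≤ k → shiftᵣ d c k ≡ k + d
shiftᵣ-≥ {_} {c} {k} c≤k with k <ᵇ c | <ᵇ⇒< k c
... | false | _   = refl
... | true  | k<c = ⊥-elim (≤⇒≯ c≤k (k<c _))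

substₛ : ℕ → Term → Sub
substₛ j s k = subst j s (var k)

ren-suc-shift : ∀ j s → ren suc (shift j 0 s) ≡ shift (suc j) 0 s
ren-suc-shift j s = begin
  ren suc (shift j 0 s)     ≡⟨ cong (ren suc) (shift₀≡ren j s) ⟩
  ren suc (ren (_+ j) s)    ≡⟨ ren-∘ suc (_+ j) s ⟩
  ren (suc ∘ (_+ j)) s      ≡⟨ ren-cong (λ k → sym (+-suc k j)) s ⟩
  ren (_+ suc j) s          ≡⟨ sym (shift₀≡ren (suc j) s) ⟩
  shift (suc j) 0 s         ∎
  where open ≡-Reasoning

liftₛ-substₛ : ∀ j s → liftₛ (substₛ j s) ≗ substₛ (suc j) s
liftₛ-substₛ j s zero = refl
liftₛ-substₛ j s (suc k) with compare k j
... | less .k m    = refl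
... | equal .k     = ren-suc-shift k s
... | greater .j m = refl

subst≡sub : ∀ j s t → subst j s t ≡ sub (substₛ j s) t
subst≡sub j s (var k)   = refl
subst≡sub j s (lam t)   = cong lam (trans (subst≡sub (suc j) s t) (sym (sub-cong (liftₛ-substₛ j s) t)))
subst≡sub j s (app t u) = cong₂ app (subst≡sub j s t) (subst≡sub j s u)

subst₀≡[]₀ : ∀ s t → subst 0 s t ≡ t [ s ]₀
subst₀≡[]₀ s t = trans (subst≡sub 0 s t) (sub-cong pointwise t)
  where
  pointwise : substₛ 0 s ≗ s • var
  pointwise zero    = trans (shift₀≡ren 0 s) (ren-identity +-identityʳ s)
  pointwise (suc k) = refl

subst-var-< : k < j → subst j s (var k) ≡ var k
subst-var-< {k} {j} k<j with compare k j
... | less .k m    = refl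
... | equal .k     = ⊥-elim (<-irrefl refl k<j)
... | greater .j m = ⊥-elim (<-irrefl refl (<-trans k<j (s≤s (m≤m+n j m))))

subst-var-≡ : ∀ j s → subst j s (var j) ≡ shift j 0 s
subst-var-≡ j s = with-index refl
  where
  with-index : k ≡ j → subst j s (var k) ≡ shift j 0 s
  with-index {k} k≡j with compare k j
  ... | less .k m    = ⊥-elim (<-irrefl k≡j (s≤s (m≤m+n k m)))
  ... | equal .k     = refl
  ... | greater .j m = ⊥-elim (<-irrefl (sym k≡j) (s≤s (m≤m+n j m)))

subst-var-> : j ≤ k → subst j s (var (suc k)) ≡ var k
subst-var-> {j} {k} j≤k with compare (suc k) j
... | less .(suc k) m = ⊥-elim (<-irrefl refl (≤-trans (s≤s (≤-trans (m≤m+n k m) (n≤1+n _))) j≤k))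
... | equal .(suc k)  = ⊥-elim (<-irrefl refl (s≤s j≤k))
... | greater .j m    = refl

module _ {R : Term → Term → Set} where

  lam* : Star (Compat R) t u → Star (Compat R) (lam t) (lam u)
  lam* = Star.gmap lam lamᶜ

  appˡ* : Star (Compat R) t t' → Star (Compat R) (app t u) (app t' u)
  appˡ* = Star.gmap _ appˡ

  appʳ* : Star (Compat R) u u' → Star (Compat R) (app t u) (app t u')
  appʳ* = Star.gmap _ appʳ

  app* : Star (Compat R) t t' → Star (Compat R) u u' → Star (Compat R) (app t u) (app t' u')
  app* p q = appˡ* p ◅◅ appʳ* q

_→β*_ _⊸*_ _→g*_ _→a*_ : Term → Term → Set
_→β*_ = Star _→β_
_⊸*_  = Star _⊸_
_→g*_ = Star _→g_
_→a*_ = Star _→a_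

β-[]₀ : ∀ b a → app (lam b) a →β b [ a ]₀
β-[]₀ b a = transport (app (lam b) a →β_) (subst₀≡[]₀ a b) (root (beta b a))

β-sub : ∀ σ → t →β u → sub σ t →β sub σ u
β-sub σ (root (beta b a)) = transport (app (lam (sub (liftₛ σ) b)) (sub σ a) →β_) eq (β-[]₀ _ _)
  where
  eq : sub (liftₛ σ) b [ sub σ a ]₀ ≡ sub σ (subst 0 a b)
  eq = trans (sym (sub-[]₀ σ a b)) (cong (sub σ) (sym (subst₀≡[]₀ a b)))
β-sub σ (lamᶜ p) = lamᶜ (β-sub (liftₛ σ) p)
β-sub σ (appˡ p) = appˡ (β-sub σ p)
β-sub σ (appʳ p) = appʳ (β-sub σ p)

β*-sub : ∀ σ → t →β* u → sub σ t →β* sub σ u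
β*-sub σ = Star.gmap (sub σ) (β-sub σ)

infix 4 _⇛_
data _⇛_ : Term → Term → Set where
  ⇛-var : var k ⇛ var k
  ⇛-lam : t ⇛ t' → lam t ⇛ lam t'
  ⇛-app : t ⇛ t' → u ⇛ u' → app t u ⇛ app t' u'
  ⇛-β   : t ⇛ t' → u ⇛ u' → app (lam t) u ⇛ t' [ u' ]₀

⇛-refl : ∀ t → t ⇛ t
⇛-refl (var k)   = ⇛-var
⇛-refl (lam t)   = ⇛-lam (⇛-refl t)
⇛-refl (app t u) = ⇛-app (⇛-refl t) (⇛-refl u)

⇛-ren : ∀ ρ → t ⇛ t' → ren ρ t ⇛ ren ρ t'
⇛-ren ρ ⇛-var       = ⇛-var
⇛-ren ρ (⇛-lam p)   = ⇛-lam (⇛-ren (liftᵣ ρ) p)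
⇛-ren ρ (⇛-app p q) = ⇛-app (⇛-ren ρ p) (⇛-ren ρ q)
⇛-ren ρ (⇛-β {t' = t'} {u' = u'} p q) =
  transport (_ ⇛_) (sym (ren-[]₀ ρ u' t')) (⇛-β (⇛-ren (liftᵣ ρ) p) (⇛-ren ρ q))

⇛-liftₛ : ∀ {σ σ'} → (∀ k → σ k ⇛ σ' k) → ∀ k → liftₛ σ k ⇛ liftₛ σ' k
⇛-liftₛ e zero    = ⇛-var
⇛-liftₛ e (suc k) = ⇛-ren suc (e k)

⇛-sub : ∀ {σ σ'} → (∀ k → σ k ⇛ σ' k) → t ⇛ t' → sub σ t ⇛ sub σ' t'
⇛-sub e ⇛-var       = e _
⇛-sub e (⇛-lam p)   = ⇛-lam (⇛-sub (⇛-liftₛ e) p)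
⇛-sub e (⇛-app p q) = ⇛-app (⇛-sub e p) (⇛-sub e q)
⇛-sub {σ' = σ'} e (⇛-β {t' = t'} {u' = u'} p q) =
  transport (_ ⇛_) (sym (sub-[]₀ σ' u' t')) (⇛-β (⇛-sub (⇛-liftₛ e) p) (⇛-sub e q))

⇛-[]₀ : t ⇛ t' → u ⇛ u' → t [ u ]₀ ⇛ t' [ u' ]₀
⇛-[]₀ p q = ⇛-sub (λ { zero → q ; (suc k) → ⇛-var }) p

→β⇒⇛ : t →β u → t ⇛ u
→β⇒⇛ (root (beta t s)) = transport (app (lam t) s ⇛_) (sym (subst₀≡[]₀ s t)) (⇛-β (⇛-refl t) (⇛-refl s))
→β⇒⇛ (lamᶜ p) = ⇛-lam (→β⇒⇛ p)
→β⇒⇛ (appˡ p) = ⇛-app (→β⇒⇛ p) (⇛-refl _)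
→β⇒⇛ (appʳ p) = ⇛-app (⇛-refl _) (→β⇒⇛ p)

⇛⇒→β* : t ⇛ u → t →β* u
⇛⇒→β* ⇛-var       = ε
⇛⇒→β* (⇛-lam p)   = lam* (⇛⇒→β* p)
⇛⇒→β* (⇛-app p q) = app* (⇛⇒→β* p) (⇛⇒→β* q)
⇛⇒→β* (⇛-β {t' = t'} {u' = u'} p q) = app* (lam* (⇛⇒→β* p)) (⇛⇒→β* q) ◅◅ β-[]₀ t' u' ◅ ε

develop : Term → Term
develop (var k)             = var k
develop (lam t)             = lam (develop t)
develop (app (var k) u)     = app (var k) (develop u)
develop (app (lam t) u)     = develop t [ develop u ]₀
develop (app (app t t') u)  = app (develop (app t t')) (develop u)

⇛-develop : t ⇛ u → u ⇛ develop t
⇛-develop ⇛-var                          = ⇛-var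
⇛-develop (⇛-lam p)                      = ⇛-lam (⇛-develop p)
⇛-develop (⇛-app {var _} ⇛-var q)        = ⇛-app ⇛-var (⇛-develop q)
⇛-develop (⇛-app {lam _} (⇛-lam p) q)    = ⇛-β (⇛-develop p) (⇛-develop q)
⇛-develop (⇛-app {app _ _} p q)          = ⇛-app (⇛-develop p) (⇛-develop q)
⇛-develop (⇛-β p q)                      = ⇛-[]₀ (⇛-develop p) (⇛-develop q)

⇛*-strip : ∀ {v} → t ⇛ u → Star _⇛_ t v → ∃ λ w → Star _⇛_ u w × v ⇛ w
⇛*-strip p ε = _ , ε , p
⇛*-strip p (q ◅ qs) with ⇛*-strip (⇛-develop q) qs
... | w , r , s = w , ⇛-develop p ◅ r , s

⇛-confluent : Confluent _⇛_
⇛-confluent ε qs = _ , qs , ε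
⇛-confluent (p ◅ ps) qs with ⇛*-strip p qs
... | w , r , s with ⇛-confluent ps r
... | w' , r₁ , r₂ = w' , r₁ , s ◅ r₂

→β-confluent : Confluent _→β_
→β-confluent p q with ⇛-confluent (Star.map →β⇒⇛ p) (Star.map →β⇒⇛ q)
... | w , r , s = w , Star.concat (Star.map ⇛⇒→β* r) , Star.concat (Star.map ⇛⇒→β* s)

church-rosser : t =β u → ∃ λ s → t →β* s × u →β* s
church-rosser ε = _ , ε , ε
church-rosser (fwd p ◅ ps) with church-rosser ps
... | s , r₁ , r₂ = s , p ◅ r₁ , r₂
church-rosser (bwd p ◅ ps) with church-rosser ps
... | s , r₁ , r₂ with →β-confluent (p ◅ ε) r₁
... | w , q₁ , q₂ = w , q₁ , r₂ ◅◅ q₂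

+-suc-swap : ∀ a b i → a + suc b + i ≡ b + suc (a + i)
+-suc-swap = solve-∀

-- sub (contractᴱ E) is the effect of contracting every redex of E on the term in its hole.
contractᴱ : ECtx → Sub
contractᴱ hole           = var
contractᴱ (ext E₁ E₂ r) = sub (r • contractᴱ E₁) ∘ contractᴱ E₂

plugE-→β*-contractᴱ : ∀ E M → plugE E M →β* sub (contractᴱ E) M
redex-→β*-contractᴱ : ∀ E B s → app (plugE E (lam B)) s →β* sub (s • contractᴱ E) B

plugE-→β*-contractᴱ hole M = ≡⇒Star _ (sym (sub-var M))
plugE-→β*-contractᴱ (ext E₁ E₂ r) M =
  redex-→β*-contractᴱ E₁ (plugE E₂ M) r ◅◅
  β*-sub (r • contractᴱ E₁) (plugE-→β*-contractᴱ E₂ M) ◅◅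
  ≡⇒Star _ (sub-sub (r • contractᴱ E₁) (contractᴱ E₂) M)

redex-→β*-contractᴱ E B s =
  appˡ* (plugE-→β*-contractᴱ E (lam B)) ◅◅
  β-[]₀ (sub (liftₛ (contractᴱ E)) B) s ◅
  ≡⇒Star _ (sub-[]₀-liftₛ s (contractᴱ E) B)

contractᴱ-outside : ∀ E i → contractᴱ E (depthE E + i) ≡ var i
contractᴱ-outside hole i = refl
contractᴱ-outside (ext E₁ E₂ r) i = begin
  sub (r • contractᴱ E₁) (contractᴱ E₂ (n₁ + suc n₂ + i))
    ≡⟨ cong (sub (r • contractᴱ E₁) ∘ contractᴱ E₂) (+-suc-swap n₁ n₂ i) ⟩
  sub (r • contractᴱ E₁) (contractᴱ E₂ (n₂ + suc (n₁ + i)))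
    ≡⟨ cong (sub (r • contractᴱ E₁)) (contractᴱ-outside E₂ (suc (n₁ + i))) ⟩
  contractᴱ E₁ (n₁ + i)
    ≡⟨ contractᴱ-outside E₁ i ⟩
  var i
    ∎
  where
  open ≡-Reasoning
  n₁ = depthE E₁
  n₂ = depthE E₂

liftₛ^ : ℕ → Sub → Sub
liftₛ^ zero    τ = τ
liftₛ^ (suc n) τ = liftₛ^ n (liftₛ τ)

sub-plug-cong : ∀ C τ {x y} → sub (liftₛ^ (depth C) τ) x ≡ sub (liftₛ^ (depth C) τ) y →
                sub τ (plug C x) ≡ sub τ (plug C y)
sub-plug-cong hole       τ e = e
sub-plug-cong (lamC C)   τ e = cong lam (sub-plug-cong C (liftₛ τ) e)
sub-plug-cong (appL C t) τ e = cong (λ z → app z (sub τ t)) (sub-plug-cong C τ e)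
sub-plug-cong (appR t C) τ e = cong (app (sub τ t)) (sub-plug-cong C τ e)

liftₛ^-+ : ∀ d τ k → liftₛ^ d τ (k + d) ≡ ren (_+ d) (τ k)
liftₛ^-+ zero τ k = trans (cong τ (+-identityʳ k)) (sym (ren-identity +-identityʳ (τ k)))
liftₛ^-+ (suc d) τ k = begin
  liftₛ^ d (liftₛ τ) (k + suc d)    ≡⟨ cong (liftₛ^ d (liftₛ τ)) (+-suc k d) ⟩
  liftₛ^ d (liftₛ τ) (suc k + d)    ≡⟨ liftₛ^-+ d (liftₛ τ) (suc k) ⟩
  ren (_+ d) (ren suc (τ k))        ≡⟨ ren-∘ (_+ d) suc (τ k) ⟩
  ren (λ i → suc i + d) (τ k)       ≡⟨ ren-cong (λ i → sym (+-suc i d)) (τ k) ⟩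
  ren (_+ suc d) (τ k)              ∎
  where open ≡-Reasoning

joinable⇒=β : ∀ {a b c} → a →β* c → b →β* c → a =β b
joinable⇒=β p q = a—↠b⇒a↔b p ◅◅ a—↠b⇒b↔a q

linroot⇒=β : linroot t u → t =β u
linroot⇒=β (lin E C s) =
  joinable⇒=β (redex-→β*-contractᴱ E _ s ◅◅ ≡⇒Star _ copy-vanishes) (redex-→β*-contractᴱ E _ s)
  where
  n = depthE E
  d = depth C
  τ = s • contractᴱ E
  -- Under contractᴱ E the copy of s, shifted past the binders of E and C, is s again.
  copy-vanishes : sub τ (plug C (var d)) ≡ sub τ (plug C (shift (n + suc d) 0 s))
  copy-vanishes = sub-plug-cong C τ (begin
    liftₛ^ d τ (0 + d)                             ≡⟨ liftₛ^-+ d τ 0 ⟩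
    ren (_+ d) s                                   ≡⟨ sym (sub-var∘ (_+ d) s) ⟩
    sub (var ∘ (_+ d)) s                           ≡⟨ sym (sub-cong pointwise s) ⟩
    sub (liftₛ^ d τ ∘ (_+ (n + suc d))) s          ≡⟨ sym (sub-ren (liftₛ^ d τ) (_+ (n + suc d)) s) ⟩
    sub (liftₛ^ d τ) (ren (_+ (n + suc d)) s)      ≡⟨ cong (sub (liftₛ^ d τ)) (sym (shift₀≡ren (n + suc d) s)) ⟩
    sub (liftₛ^ d τ) (shift (n + suc d) 0 s)       ∎)
    where
    open ≡-Reasoning
    reassoc : ∀ k n d → k + (n + suc d) ≡ suc (n + k) + d
    reassoc = solve-∀
    pointwise : ∀ k → liftₛ^ d τ (k + (n + suc d)) ≡ var (k + d)
    pointwise k = begin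
      liftₛ^ d τ (k + (n + suc d))        ≡⟨ cong (liftₛ^ d τ) (reassoc k n d) ⟩
      liftₛ^ d τ (suc (n + k) + d)        ≡⟨ liftₛ^-+ d τ (suc (n + k)) ⟩
      ren (_+ d) (contractᴱ E (n + k))    ≡⟨ cong (ren (_+ d)) (contractᴱ-outside E k) ⟩
      var (k + d)                         ∎

garbroot⇒=β : garbroot t u → t =β u
garbroot⇒=β (garb E t s) =
  joinable⇒=β (redex-→β*-contractᴱ E _ s ◅◅ ≡⇒Star _ garbage-vanishes) (plugE-→β*-contractᴱ E t)
  where
  garbage-vanishes : sub (s • contractᴱ E) (shift 1 0 t) ≡ sub (contractᴱ E) t
  garbage-vanishes = begin
    sub (s • contractᴱ E) (shift 1 0 t)   ≡⟨ cong (sub (s • contractᴱ E)) (shift₁≡ren-suc t) ⟩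
    sub (s • contractᴱ E) (ren suc t)     ≡⟨ sub-•-ren-suc s (contractᴱ E) t ⟩
    sub (contractᴱ E) t                   ∎
    where open ≡-Reasoning

Compat⇒=β : ∀ {R : Term → Term → Set} → (∀ {t u} → R t u → t =β u) → Compat R t u → t =β u
Compat⇒=β f (root p) = f p
Compat⇒=β f (lamᶜ p) = EqClosure.gmap lam lamᶜ (Compat⇒=β f p)
Compat⇒=β f (appˡ p) = EqClosure.gmap _ appˡ (Compat⇒=β f p)
Compat⇒=β f (appʳ p) = EqClosure.gmap _ appʳ (Compat⇒=β f p)

→a⇒=β : t →a u → t =β u
→a⇒=β (inj₁ p) = Compat⇒=β linroot⇒=β p
→a⇒=β (inj₂ p) = Compat⇒=β garbroot⇒=β p

→a*⇒=β : t →a* u → t =β u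
→a*⇒=β = Star.concat ∘ Star.map →a⇒=β

-- Contexts stored inside-out, so that ⊸*-replace descends into a term by extending the
-- context at its hole; rdepth K is the index of the variable bound just outside K.
data RCtx : Set where
  rhole : RCtx
  rlam  : RCtx → RCtx
  rappL : RCtx → Term → RCtx
  rappR : Term → RCtx → RCtx

rplug : RCtx → Term → Term
rplug rhole       t = t
rplug (rlam K)    t = rplug K (lam t)
rplug (rappL K u) t = rplug K (app t u)
rplug (rappR u K) t = rplug K (app u t)

rdepth : RCtx → ℕ
rdepth rhole       = 0
rdepth (rlam K)    = suc (rdepth K)
rdepth (rappL K _) = rdepth K
rdepth (rappR _ K) = rdepth K

toCtx : RCtx → Ctx → Ctx
toCtx rhole       C = C
toCtx (rlam K)    C = toCtx K (lamC C)
toCtx (rappL K u) C = toCtx K (appL C u)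
toCtx (rappR u K) C = toCtx K (appR u C)

plug-toCtx : ∀ K C t → plug (toCtx K C) t ≡ rplug K (plug C t)
plug-toCtx rhole       C t = refl
plug-toCtx (rlam K)    C t = plug-toCtx K (lamC C) t
plug-toCtx (rappL K u) C t = plug-toCtx K (appL C u) t
plug-toCtx (rappR u K) C t = plug-toCtx K (appR u C) t

depth-toCtx : ∀ K C → depth (toCtx K C) ≡ rdepth K + depth C
depth-toCtx rhole       C = refl
depth-toCtx (rlam K)    C = trans (depth-toCtx K (lamC C)) (+-suc (rdepth K) (depth C))
depth-toCtx (rappL K u) C = depth-toCtx K (appL C u)
depth-toCtx (rappR u K) C = depth-toCtx K (appR u C)

-- Substitute a for the index d but keep its binder, which becomes vacuous.
replace : ℕ → Term → Term → Term
replace d a t = shift 1 d (subst d a t)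

replace-var-< : ∀ {d k a} → k < d → replace d a (var k) ≡ var k
replace-var-< {d} {k} k<d = begin
  shift 1 d (subst d _ (var k))   ≡⟨ cong (shift 1 d) (subst-var-< k<d) ⟩
  shift 1 d (var k)               ≡⟨ shift-var 1 d k ⟩
  var (shiftᵣ 1 d k)              ≡⟨ cong var (shiftᵣ-< k<d) ⟩
  var k                           ∎
  where open ≡-Reasoning

replace-var-> : ∀ {d k a} → d < k → replace d a (var k) ≡ var k
replace-var-> {d} {suc k} (s≤s d≤k) = begin
  shift 1 d (subst d _ (var (suc k)))   ≡⟨ cong (shift 1 d) (subst-var-> d≤k) ⟩
  shift 1 d (var k)                     ≡⟨ shift-var 1 d k ⟩
  var (shiftᵣ 1 d k)                    ≡⟨ cong var (trans (shiftᵣ-≥ d≤k) (+-comm k 1)) ⟩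
  var (suc k)                           ∎
  where open ≡-Reasoning

replace-var-≡ : ∀ d a → replace d a (var d) ≡ shift (suc d) 0 a
replace-var-≡ d a = begin
  shift 1 d (subst d a (var d))    ≡⟨ cong (shift 1 d) (subst-var-≡ d a) ⟩
  shift 1 d (shift d 0 a)          ≡⟨ trans (shift≡ren 1 d _) (cong (ren (shiftᵣ 1 d)) (shift₀≡ren d a)) ⟩
  ren (shiftᵣ 1 d) (ren (_+ d) a)  ≡⟨ ren-∘ (shiftᵣ 1 d) (_+ d) a ⟩
  ren (shiftᵣ 1 d ∘ (_+ d)) a      ≡⟨ ren-cong pointwise a ⟩
  ren (_+ suc d) a                 ≡⟨ sym (shift₀≡ren (suc d) a) ⟩
  shift (suc d) 0 a                ∎
  where
  open ≡-Reasoning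
  pointwise : ∀ k → shiftᵣ 1 d (k + d) ≡ k + suc d
  pointwise k = trans (shiftᵣ-≥ (m≤n+m d k)) (+-assoc-suc k d)
    where
    +-assoc-suc : ∀ k d → k + d + 1 ≡ k + suc d
    +-assoc-suc = solve-∀

⊸-occurrence : ∀ a K → app (lam (rplug K (var (rdepth K)))) a ⊸ app (lam (rplug K (shift (suc (rdepth K)) 0 a))) a
⊸-occurrence a K =
  transport₂ (λ x y → app (lam x) a ⊸ app (lam y) a) (plug-toCtx K hole _) (plug-toCtx K hole _)
    (transport (λ n → app (lam (plug C (var n))) a ⊸ app (lam (plug C (shift (suc n) 0 a))) a)
      depth-C (root (lin hole C a)))
  where
  C = toCtx K hole
  depth-C : depth C ≡ rdepth K
  depth-C = trans (depth-toCtx K hole) (+-identityʳ (rdepth K))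

⊸*-replace : ∀ a K t → app (lam (rplug K t)) a ⊸* app (lam (rplug K (replace (rdepth K) a t))) a
⊸*-replace a K (var k) = by-position (<-cmp k (rdepth K))
  where
  unchanged : ∀ {x y} → y ≡ x → app (lam (rplug K x)) a ⊸* app (lam (rplug K y)) a
  unchanged y≡x = ≡⇒Star _ (cong (λ x → app (lam (rplug K x)) a) (sym y≡x))
  by-position : Tri (k < rdepth K) (k ≡ rdepth K) (rdepth K < k) →
                app (lam (rplug K (var k))) a ⊸* app (lam (rplug K (replace (rdepth K) a (var k)))) a
  by-position (tri< k<d _ _)  = unchanged (replace-var-< k<d)
  by-position (tri≈ _ refl _) = ⊸-occurrence a K ◅ unchanged (replace-var-≡ k a)
  by-position (tri> _ _ d<k)  = unchanged (replace-var-> d<k)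
⊸*-replace a K (lam t)   = ⊸*-replace a (rlam K) t
⊸*-replace a K (app t u) = ⊸*-replace a (rappL K u) t ◅◅ ⊸*-replace a (rappR (replace (rdepth K) a t) K) u

-- t ≽[ ρ ] u: t is ren ρ u with vacuous redexes (λ t') r inserted, t' not using its bound
-- index; such a t garbage-reduces to ren ρ u.
infix 4 _≽[_]_
data _≽[_]_ : Term → Ren → Term → Set where
  ≽-var     : ∀ {ρ k j} → ρ k ≡ j → var j ≽[ ρ ] var k
  ≽-lam     : ∀ {ρ t u} → t ≽[ liftᵣ ρ ] u → lam t ≽[ ρ ] lam u
  ≽-app     : ∀ {ρ t₁ t₂ u₁ u₂} → t₁ ≽[ ρ ] u₁ → t₂ ≽[ ρ ] u₂ → app t₁ t₂ ≽[ ρ ] app u₁ u₂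
  ≽-garbage : ∀ {ρ t u} r → t ≽[ suc ∘ ρ ] u → app (lam t) r ≽[ ρ ] u

≽-ren : ∀ {α ρ ρ' β t u} → (∀ k → α (ρ k) ≡ ρ' (β k)) → t ≽[ ρ ] u → ren α t ≽[ ρ' ] ren β u
≽-ren e (≽-var {k = k} refl) = ≽-var (sym (e k))
≽-ren e (≽-lam p)            = ≽-lam (≽-ren (λ { zero → refl ; (suc k) → cong suc (e k) }) p)
≽-ren e (≽-app p q)          = ≽-app (≽-ren e p) (≽-ren e q)
≽-ren e (≽-garbage r p)      = ≽-garbage _ (≽-ren (cong suc ∘ e) p)

ren-≽ : ∀ ρ u → ren ρ u ≽[ ρ ] u
ren-≽ ρ (var k)   = ≽-var refl
ren-≽ ρ (lam u)   = ≽-lam (ren-≽ (liftᵣ ρ) u)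
ren-≽ ρ (app u v) = ≽-app (ren-≽ ρ u) (ren-≽ ρ v)

≽-refl : ∀ u → u ≽[ id ] u
≽-refl u = transport (_≽[ id ] u) (ren-id u) (ren-≽ id u)

≽-cong : ∀ {ρ ρ' t u} → ρ ≗ ρ' → t ≽[ ρ ] u → t ≽[ ρ' ] u
≽-cong e p = transport₂ (_≽[ _ ]_) (ren-id _) (ren-id _) (≽-ren e p)

≽⇒→g* : ∀ {ρ t u} → t ≽[ ρ ] u → t →g* ren ρ u
≽⇒→g* (≽-var refl)  = ε
≽⇒→g* (≽-lam p)     = lam* (≽⇒→g* p)
≽⇒→g* (≽-app p q)   = app* (≽⇒→g* p) (≽⇒→g* q)
≽⇒→g* {ρ} {u = u} (≽-garbage r p) =
  appˡ* (lam* (≽⇒→g* p)) ◅◅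
  transport (λ x → app (lam x) r →g* ren ρ u) vacuous (root (garb hole (ren ρ u) r) ◅ ε)
  where
  vacuous : shift 1 0 (ren ρ u) ≡ ren (suc ∘ ρ) u
  vacuous = trans (shift₁≡ren-suc (ren ρ u)) (ren-∘ suc ρ u)

≽-id⇒→g* : ∀ {t u} → t ≽[ id ] u → t →g* u
≽-id⇒→g* {t} p = transport (t →g*_) (ren-id _) (≽⇒→g* p)

-- A term embedding C[x] with x free is C'[x'], where C' adds the garbage above the hole
-- and σ' is the renaming in force at the hole.
record PlugView (σ : Ren) (M : Term) (C : Ctx) (j : ℕ) : Set where
  constructor plugView
  field
    C'     : Ctx
    σ'     : Ren
    shape  : M ≡ plug C' (var (depth C' + σ j))
    outer  : ∀ i → σ' (depth C + i) ≡ depth C' + σ i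
    plug-≽ : ∀ {a b} → a ≽[ σ' ] b → plug C' a ≽[ σ ] plug C b

plugView-garbage : ∀ {σ X C j} r → PlugView (suc ∘ σ) X C j → PlugView σ (app (lam X) r) C j
plugView-garbage {σ} {j = j} r (plugView C' σ' refl outer plug-≽) =
  plugView (appL (lamC C') r) σ'
    (cong (λ x → app (lam (plug C' (var x))) r) (+-suc (depth C') (σ j)))
    (λ i → trans (outer i) (+-suc (depth C') (σ i)))
    (≽-garbage r ∘ plug-≽)

≽-plug-view : ∀ C {σ M j} → M ≽[ σ ] plug C (var (depth C + j)) → PlugView σ M C j
≽-plug-view hole (≽-var refl) = plugView hole _ refl (λ i → refl) id
≽-plug-view (lamC C) {σ} {lam X} {j} (≽-lam p)
  with ≽-plug-view C {j = suc j} (transport (λ x → X ≽[ liftᵣ σ ] plug C (var x)) (sym (+-suc (depth C) j)) p)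
... | plugView C' σ' refl outer plug-≽ =
  plugView (lamC C') σ'
    (cong (λ x → lam (plug C' (var x))) (+-suc (depth C') (σ j)))
    (λ i → trans (cong σ' (sym (+-suc (depth C) i))) (trans (outer (suc i)) (+-suc (depth C') (σ i))))
    (≽-lam ∘ plug-≽)
≽-plug-view (appL C t) (≽-app p q) with ≽-plug-view C p
... | plugView C' σ' refl outer plug-≽ = plugView (appL C' _) σ' refl outer (λ r → ≽-app (plug-≽ r) q)
≽-plug-view (appR t C) (≽-app p q) with ≽-plug-view C q
... | plugView C' σ' refl outer plug-≽ = plugView (appR _ C') σ' refl outer (λ r → ≽-app p (plug-≽ r))
≽-plug-view C (≽-garbage r p) = plugView-garbage r (≽-plug-view C p)

record PlugEView (ρ : Ren) (A : Term) (E : ECtx) (M : Term) : Set where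
  constructor plugEView
  field
    E'      : ECtx
    M'      : Term
    ρ'      : Ren
    shape   : A ≡ plugE E' (lam M')
    body    : M' ≽[ ρ' ] M
    bound   : ρ' 0 ≡ 0
    outer   : ∀ i → ρ' (suc (depthE E + i)) ≡ suc (depthE E' + ρ i)
    plugE-≽ : ∀ {a b} → a ≽[ ρ' ] b → plugE E' (lam a) ≽[ ρ ] plugE E (lam b)

plugEView-garbage : ∀ {ρ X E M} r → PlugEView (suc ∘ ρ) X E M → PlugEView ρ (app (lam X) r) E M
plugEView-garbage {ρ} r (plugEView E' M' ρ' refl body bound outer plugE-≽) =
  plugEView (ext hole E' r) M' ρ' refl body bound
    (λ i → trans (outer i) (cong suc (+-suc (depthE E') (ρ i))))
    (≽-garbage r ∘ plugE-≽)

≽-plugE-view : ∀ E {ρ A M} → A ≽[ ρ ] plugE E (lam M) → PlugEView ρ A E M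
≽-plugE-view hole (≽-lam p) = plugEView hole _ _ refl p refl (λ i → refl) ≽-lam
≽-plugE-view (ext E₁ E₂ q) {ρ} (≽-app p₁ pq)
  with ≽-plugE-view E₁ p₁
... | plugEView E₁' _ ρ₁ refl p₂ _ outer₁ plugE-≽₁
  with ≽-plugE-view E₂ p₂
... | plugEView E₂' M' ρ₂ refl body bound outer₂ plugE-≽₂ =
  plugEView (ext E₁' E₂' _) M' ρ₂ refl body bound outer (λ r → ≽-app (plugE-≽₁ (plugE-≽₂ r)) pq)
  where
  n₁ = depthE E₁
  n₂ = depthE E₂
  m₁ = depthE E₁'
  m₂ = depthE E₂'
  outer : ∀ i → ρ₂ (suc (n₁ + suc n₂ + i)) ≡ suc (m₁ + suc m₂ + ρ i)
  outer i = begin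
    ρ₂ (suc (n₁ + suc n₂ + i))      ≡⟨ cong (ρ₂ ∘ suc) (+-suc-swap n₁ n₂ i) ⟩
    ρ₂ (suc (n₂ + suc (n₁ + i)))    ≡⟨ outer₂ (suc (n₁ + i)) ⟩
    suc (m₂ + ρ₁ (suc (n₁ + i)))    ≡⟨ cong (suc ∘ (m₂ +_)) (outer₁ i) ⟩
    suc (m₂ + suc (m₁ + ρ i))       ≡⟨ cong suc (sym (+-suc-swap m₁ m₂ (ρ i))) ⟩
    suc (m₁ + suc m₂ + ρ i)         ∎
    where open ≡-Reasoning
≽-plugE-view E (≽-garbage r p) = plugEView-garbage r (≽-plugE-view E p)

≽-linroot : ∀ {ρ A s' s} E C → A ≽[ ρ ] plugE E (lam (plug C (var (depth C)))) → s' ≽[ ρ ] s →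
  ∃ λ t' → app A s' ⊸ t' × t' ≽[ ρ ] app (plugE E (lam (plug C (shift (depthE E + suc (depth C)) 0 s)))) s
≽-linroot {ρ} {s' = s'} {s} E C pA ps
  with ≽-plugE-view E pA
... | plugEView E' M' ρ' refl body bound outerE plugE-≽
  with ≽-plug-view C {j = 0} (transport (λ x → M' ≽[ ρ' ] plug C (var x)) (sym (+-identityʳ (depth C))) body)
... | plugView C' σ' shape outerC plug-≽ =
  _ , transport (λ x → app (plugE E' (lam x)) s' ⊸ _) (sym M'≡) (root (lin E' C' s')) ,
  ≽-app (plugE-≽ (plug-≽ copy)) ps
  where
  n = depthE E
  d = depth C
  m = depthE E'
  d' = depth C'
  M'≡ : M' ≡ plug C' (var d')
  M'≡ = trans shape (cong (λ x → plug C' (var x)) (trans (cong (d' +_) bound) (+-identityʳ d')))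
  renamings-agree : ∀ k → ρ k + (m + suc d') ≡ σ' (k + (n + suc d))
  renamings-agree k = begin
    ρ k + (m + suc d')          ≡⟨ reassoc (ρ k) m d' ⟩
    d' + suc (m + ρ k)          ≡⟨ cong (d' +_) (sym (outerE k)) ⟩
    d' + ρ' (suc (n + k))       ≡⟨ sym (outerC (suc (n + k))) ⟩
    σ' (d + suc (n + k))        ≡⟨ cong σ' (sym (reassoc k n d)) ⟩
    σ' (k + (n + suc d))        ∎
    where
    open ≡-Reasoning
    reassoc : ∀ k n d → k + (n + suc d) ≡ d + suc (n + k)
    reassoc = solve-∀
  copy : shift (m + suc d') 0 s' ≽[ σ' ] shift (n + suc d) 0 s
  copy = transport₂ (_≽[ σ' ]_) (sym (shift₀≡ren _ s')) (sym (shift₀≡ren _ s)) (≽-ren renamings-agree ps)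

≽-⊸-commute : ∀ {ρ t u v} → t ≽[ ρ ] u → u ⊸ v → ∃ λ t' → t ⊸ t' × t' ≽[ ρ ] v
≽-⊸-commute (≽-var _) (root ())
≽-⊸-commute (≽-lam p) (root ())
≽-⊸-commute (≽-lam p) (lamᶜ r) with ≽-⊸-commute p r
... | t' , r' , p' = lam t' , lamᶜ r' , ≽-lam p'
≽-⊸-commute (≽-app p q) (appˡ r) with ≽-⊸-commute p r
... | t' , r' , p' = app t' _ , appˡ r' , ≽-app p' q
≽-⊸-commute (≽-app p q) (appʳ r) with ≽-⊸-commute q r
... | t' , r' , q' = app _ t' , appʳ r' , ≽-app p q'
≽-⊸-commute (≽-app p q) (root (lin E C s)) = ≽-linroot E C p q
≽-⊸-commute (≽-garbage r p) st with ≽-⊸-commute p st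
... | t' , r' , p' = app (lam t') r , appˡ (lamᶜ r') , ≽-garbage r p'

≽-⊸*-commute : ∀ {ρ t u v} → t ≽[ ρ ] u → u ⊸* v → ∃ λ t' → t ⊸* t' × t' ≽[ ρ ] v
≽-⊸*-commute p ε = _ , ε , p
≽-⊸*-commute p (r ◅ rs) with ≽-⊸-commute p r
... | t₁ , r' , p₁ with ≽-⊸*-commute p₁ rs
... | t₂ , rs' , p₂ = t₂ , r' ◅ rs' , p₂

→β-linearise : ∀ {t u} → t →β u → ∃ λ t' → t ⊸* t' × t' ≽[ id ] u
→β-linearise (root (beta b a)) =
  _ , ⊸*-replace a rhole b ,
  ≽-garbage a (transport (_≽[ suc ] subst 0 a b) (sym (shift₁≡ren-suc (subst 0 a b)))
                         (ren-≽ suc (subst 0 a b)))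
→β-linearise (lamᶜ p) with →β-linearise p
... | t' , r , q = lam t' , lam* r , ≽-lam (≽-cong (λ { zero → refl ; (suc k) → refl }) q)
→β-linearise (appˡ p) with →β-linearise p
... | t' , r , q = app t' _ , appˡ* r , ≽-app q (≽-refl _)
→β-linearise (appʳ p) with →β-linearise p
... | t' , r , q = app _ t' , appʳ* r , ≽-app (≽-refl _) q

→β*⇒⊸*→g* : ∀ {t s} → t →β* s → ∃ λ s' → t ⊸* s' × s' →g* s
→β*⇒⊸*→g* ε = _ , ε , ε
→β*⇒⊸*→g* (p ◅ ps) with →β*⇒⊸*→g* ps
... | s₁ , r₁ , g₁ with →β-linearise p
... | t' , r , q with ≽-⊸*-commute q r₁
... | w , r' , q' = w , r ◅◅ r' , ≽-id⇒→g* q' ◅◅ g₁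

→β*⇒→a* : t →β* s → t →a* s
→β*⇒→a* p with →β*⇒⊸*→g* p
... | _ , l , g = Star.map inj₁ l ◅◅ Star.map inj₂ g

→a*-common-β-reduct : t →a* u → ∃ λ s → t →β* s × u →a* s
→a*-common-β-reduct p with church-rosser (→a*⇒=β p)
... | s , t↠s , u↠s = s , t↠s , →β*⇒→a* u↠s

proposition14 :
    ((t s : Term) → Star _→β_ t s →
      Star _→a_ t s × ∃ (λ s' → Star _⊸_ t s' × Star _→g_ s' s))
    ×
    ((t u : Term) → Star _→a_ t u →
      (u =β t) × ∃ (λ s → Star _→β_ t s × Star _→a_ u s))
proposition14 =
  (λ t s t↠s → →β*⇒→a* t↠s , →β*⇒⊸*→g* t↠s) ,
  (λ t u t↠u → EqClosure.symmetric _→β_ (→a*⇒=β t↠u) , →a*-common-β-reduct t↠u)
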